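{- Let $n\ge3$. The map $\Theta$ defined below is an injective map from $\mathrm{And}_{n-1}^{I}$ into $\mathrm{And}_n^{I}$ whose image is exactly the set $H_n$ of hooked permutations of $\mathrm{And}_n^I$. Moreover, for each $w\in\mathrm{And}_{n-1}^{I}$: $\mathbf{spi}\,\Theta(w)=1+\mathbf{F}\,w$; and $\mathbf{grn}\,\Theta(w)=1+\mathbf{grn}\,w$ if $\mathbf{F}\,w<\mathbf{grn}\,w$, while $\mathbf{grn}\,\Theta(w)=\mathbf{grn}\,w$ if $\mathbf{F}\,w>\mathbf{grn}\,w$.
   Context: Andr\'e I permutations: words are permutations of finite sets $Y$ of positive integers; the empty word and one-letter words are Andr\'e I; for $|Y|\ge2$ write $w=v\,\min(w)\,v'$; $w$ is Andr\'e I if $v,v'$ are Andr\'e I and $\max(vv')$ is a letter of $v'$. $\mathrm{And}_n^{I}$: Andr\'e I permutations of $\{1,\dots,n\}$. For $w=x_1\cdots x_n$: $\mathbf{F}\,w=x_1$; $\mathbf{grn}\,w=\max\{x_{i-1},x_{i+1}\}$ where $x_i$ is the maximum letter, with $x_0=x_{n+1}=0$; $\mathbf{spi}\,w$ is the letter $x_i$ such that $x_1\le x_j$ for all $j\le i$ and $x_1>x_{i+1}$ (convention $x_{n+1}=0$). Hooked: $w=x_1\cdots x_n\in\mathrm{And}_n^I$ ($n\ge3$) is hooked if $x_1-1=x_2<x_3$ or $x_1+1=x_2>x_3$; $H_n$ is the set of hooked elements of $\mathrm{And}_n^I$. Definition of $\Theta$: for $w=x_1x_2\cdots x_{n-1}\in\mathrm{And}_{n-1}^I$,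 let $x'_i=x_i$ if $x_i<x_1$ and $x'_i=x_i+1$ if $x_i>x_1$; then $\Theta(w)=(x_1+1)\,x_1\,x'_2\cdots x'_{n-1}$ if $x_1<x_2$, and $\Theta(w)=x_1\,(x_1+1)\,x'_2\cdots x'_{n-1}$ if $x_1>x_2$. -}

module Defs where

open import Data.Nat using (ℕ; zero; suc; _⊔_; _<_; _<ᵇ_; _≡ᵇ_)
open import Data.Bool using (if_then_else_)
open import Data.List using (List; []; _∷_; _++_; map; foldr; upTo)
open import Data.List.Relation.Unary.All using (All)
open import Data.List.Membership.Propositional using (_∈_)
open import Data.List.Relation.Binary.Permutation.Propositional using (_↭_)
open import Data.Product using (_×_)
open import Data.Empty using (⊥)
open import Relation.Binary.PropositionalEquality using (_≡_)

-- Words are lists of natural numbers (letters are positive integers).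

-- maximum letter of a word (0 for the empty word; letters are positive)
maxL : List ℕ → ℕ
maxL = foldr _⊔_ 0

-- André I words, following the recursive definition: for |Y| ≥ 2 write
-- w = v · min(w) · v'; w is André I iff v, v' are André I and max(vv') is a
-- letter of v'.  (The condition  maxL (v ++ v') ∈ v'  forces vv' nonempty,
-- i.e. |Y| ≥ 2.)  Letters are assumed distinct (we only use this on
-- permutations), so "m = min(w)" is "every letter of vv' exceeds m".
data AndreI : List ℕ → Set where
  andre-nil    : AndreI []
  andre-single : (x : ℕ) → AndreI (x ∷ [])
  andre-split  : (v : List ℕ) (m : ℕ) (v' : List ℕ) →
                 AndreI v → AndreI v' →
                 All (m <_) (v ++ v') →
                 maxL (v ++ v') ∈ v' →
                 AndreI (v ++ m ∷ v')

range1 : ℕ → List ℕ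
range1 n = map suc (upTo n)

And : ℕ → List ℕ → Set
And n w = (w ↭ range1 n) × AndreI w

F : List ℕ → ℕ
F []      = 0
F (x ∷ _) = x

head0 : List ℕ → ℕ
head0 []      = 0
head0 (x ∷ _) = x

-- grn w = max of the two neighbours of the maximum letter, padding x₀ = x_{n+1} = 0
grnGo : ℕ → ℕ → List ℕ → ℕ
grnGo m prev []       = 0
grnGo m prev (x ∷ xs) = if x ≡ᵇ m then prev ⊔ head0 xs else grnGo m x xs

grn : List ℕ → ℕ
grn w = grnGo (maxL w) 0 w

-- spi w = x_i where i is the least index with x_{i+1} < x_1 (x_{n+1} = 0);
-- then x_1 ≤ x_j for all j ≤ i automatically.
spiGo : ℕ → ℕ → List ℕ → ℕ
spiGo x1 last []       = last
spiGo x1 last (y ∷ ys) = if y <ᵇ x1 then last else spiGo x1 y ys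

spi : List ℕ → ℕ
spi []       = 0
spi (x ∷ xs) = spiGo x x xs

Hooked : List ℕ → Set
Hooked (x1 ∷ x2 ∷ x3 ∷ _) = (x1 ≡ suc x2 × x2 < x3) Data.Sum.⊎ (suc x1 ≡ x2 × x3 < x2)
  where import Data.Sum
Hooked _ = ⊥

-- the map Θ (defined for words of length ≥ 2; identity otherwise, never used)
bump : ℕ → ℕ → ℕ
bump x1 y = if y <ᵇ x1 then y else suc y

Θ : List ℕ → List ℕ
Θ (x1 ∷ x2 ∷ rest) =
  if x1 <ᵇ x2 then suc x1 ∷ x1 ∷ map (bump x1) (x2 ∷ rest)
              else x1 ∷ suc x1 ∷ map (bump x1) (x2 ∷ rest)
Θ w = w

-- Θ w is w with the letter x₁ + 1 inserted next to its first letter x₁ and every letter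
-- above x₁ shifted up by one. Shifting is an order embedding, so it respects the André
-- decomposition w = v · min w · v′: if v is nonempty then min w < x₁ stays in place and Θ
-- acts on v alone, and if v is empty then x₁ = min w and Θ w = (x₁+1) · x₁ · v′ with v′
-- shifted. Induction on the decomposition shows that Θ preserves André I words. A hooked
-- word begins with c, c + 1 in some order; merging them into c and shifting the remaining
-- letters down inverts Θ, and the same induction shows that this preserves André I words.
-- The maximum of an André I word is not its first letter, so Θ only shifts it and its
-- neighbours, and grn (Θ w) is grn w shifted past x₁.
module Submission where

open import Defs
open import Data.Nat
  using (ℕ; zero; suc; _+_; _∸_; pred; _≤_; _<_; _⊔_; _⊓_; _<ᵇ_; _≡ᵇ_; z≤n; s≤s; s≤s⁻¹; _≟_; _<?_)
open import Data.Nat.Properties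
open import Data.Bool using (true; false; if_then_else_)
open import Data.List using (List; []; _∷_; _++_; map; upTo; length; drop; take; [_])
open import Data.List.Properties using (map-++; length-map; length-upTo; upTo-∷ʳ)
open import Data.List.Relation.Unary.All as All using (All; []; _∷_)
import Data.List.Relation.Unary.All.Properties as All
open import Data.List.Relation.Unary.Unique.Propositional using (Unique)
open import Data.List.Relation.Unary.AllPairs using ([]; _∷_)
import Data.List.Relation.Unary.Unique.Propositional.Properties as Unique
open import Data.List.Membership.Propositional using (_∈_)
open import Data.List.Membership.Propositional.Properties using (∈-map⁺; ∈-map⁻; ∈-++⁺ʳ; ∈-upTo⁻)
open import Data.List.Relation.Unary.Any using (here; there)
open import Data.List.Relation.Binary.Permutation.Propositional
  using (_↭_; ↭-refl; ↭-prep; ↭-swap; ↭-trans; ↭-sym; ↭-reflexive; ↭⇒↭ₛ; module PermutationReasoning)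
open import Data.List.Relation.Binary.Permutation.Propositional.Properties
  using (All-resp-↭; ∈-resp-↭; ↭-length; map⁺; drop-∷; ++-comm; ++⁺ʳ; shift)
import Data.List.Relation.Binary.Permutation.Setoid.Properties as ↭ₛ
open import Data.Product as Product using (Σ; ∃-syntax; _×_; _,_; proj₁; proj₂; uncurry)
open import Data.Sum using (inj₁; inj₂)
open import Data.Unit using (⊤)
open import Function using (_∘_)
open import Relation.Binary using (_Preserves_⟶_; tri<; tri≈; tri>)
open import Relation.Nullary using (Dec; yes; no; contradiction)
open import Relation.Binary.PropositionalEquality
  using (_≡_; _≢_; refl; sym; trans; cong; cong₂; subst; subst₂; ≢-sym; setoid; module ≡-Reasoning)

private variable
  a c k m x y : ℕ
  v v' xs ys : List ℕ

<⇒<ᵇ≡true : x < y → (x <ᵇ y) ≡ true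
<⇒<ᵇ≡true {zero}  {suc y} _       = refl
<⇒<ᵇ≡true {suc x} {suc y} (s≤s p) = <⇒<ᵇ≡true p

≥⇒<ᵇ≡false : ∀ {x y} → y ≤ x → (x <ᵇ y) ≡ false
≥⇒<ᵇ≡false {x}     {zero}  _       = refl
≥⇒<ᵇ≡false {suc x} {suc y} (s≤s p) = ≥⇒<ᵇ≡false p

≡ᵇ-refl : ∀ x → (x ≡ᵇ x) ≡ true
≡ᵇ-refl zero    = refl
≡ᵇ-refl (suc x) = ≡ᵇ-refl x

≢⇒≡ᵇ≡false : x ≢ y → (x ≡ᵇ y) ≡ false
≢⇒≡ᵇ≡false {zero}  {zero}  x≢y = contradiction refl x≢y
≢⇒≡ᵇ≡false {zero}  {suc y} _   = refl
≢⇒≡ᵇ≡false {suc x} {zero}  _   = refl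
≢⇒≡ᵇ≡false {suc x} {suc y} x≢y = ≢⇒≡ᵇ≡false (x≢y ∘ cong suc)

bump-< : y < a → bump a y ≡ y
bump-< y<a rewrite <⇒<ᵇ≡true y<a = refl

bump-≥ : a ≤ y → bump a y ≡ suc y
bump-≥ a≤y rewrite ≥⇒<ᵇ≡false a≤y = refl

bump-self : ∀ a → bump a a ≡ suc a
bump-self a = bump-≥ ≤-refl

≤-bump : ∀ a y → y ≤ bump a y
≤-bump a y with y <? a
... | yes y<a = ≤-reflexive (sym (bump-< y<a))
... | no  y≮a = ≤-trans (n≤1+n y) (≤-reflexive (sym (bump-≥ (≮⇒≥ y≮a))))

bump-strictMono : ∀ a → x < y → bump a x < bump a y
bump-strictMono {x} {y} a x<y with x <? a | y <? a
... | yes x<a | yes y<a rewrite bump-< x<a | bump-< y<a = x<y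
... | yes x<a | no  y≮a rewrite bump-< x<a | bump-≥ (≮⇒≥ y≮a) = m<n⇒m<1+n x<y
... | no  x≮a | yes y<a = contradiction (<-trans x<y y<a) x≮a
... | no  x≮a | no  y≮a rewrite bump-≥ (≮⇒≥ x≮a) | bump-≥ (≮⇒≥ y≮a) = s≤s x<y

bump-mono : ∀ a → bump a Preserves _≤_ ⟶ _≤_
bump-mono a x≤y with m≤n⇒m<n∨m≡n x≤y
... | inj₁ x<y  = <⇒≤ (bump-strictMono a x<y)
... | inj₂ refl = ≤-refl

bump-injective : ∀ a → bump a x ≡ bump a y → x ≡ y
bump-injective {x} {y} a eq with <-cmp x y
... | tri< x<y _ _ = contradiction eq (<⇒≢ (bump-strictMono a x<y))
... | tri≈ _ x≡y _ = x≡y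
... | tri> _ _ y<x = contradiction (sym eq) (<⇒≢ (bump-strictMono a y<x))

unbump : ℕ → ℕ → ℕ
unbump c y = if c <ᵇ y then pred y else y

unbump-> : c < y → unbump c y ≡ pred y
unbump-> c<y rewrite <⇒<ᵇ≡true c<y = refl

unbump-≤ : y ≤ c → unbump c y ≡ y
unbump-≤ y≤c rewrite ≥⇒<ᵇ≡false y≤c = refl

unbump-self : ∀ c → unbump c c ≡ c
unbump-self c = unbump-≤ ≤-refl

unbump-suc : ∀ c → unbump c (suc c) ≡ c
unbump-suc c = unbump-> (n<1+n c)

unbump-bump : ∀ c y → unbump c (bump c y) ≡ y
unbump-bump c y with y <? c
... | yes y<c rewrite bump-< y<c = unbump-≤ (<⇒≤ y<c)
... | no  y≮c rewrite bump-≥ (≮⇒≥ y≮c) = unbump-> (s≤s (≮⇒≥ y≮c))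

bump-unbump : ∀ c y → y ≢ c → bump c (unbump c y) ≡ y
bump-unbump c y y≢c with c <? y
bump-unbump c (suc y) _ | yes c<1+y rewrite unbump-> c<1+y = bump-≥ (s≤s⁻¹ c<1+y)
... | no  c≮y rewrite unbump-≤ (≮⇒≥ c≮y) = bump-< (≤∧≢⇒< (≮⇒≥ c≮y) y≢c)

unbump-mono : ∀ c → unbump c Preserves _≤_ ⟶ _≤_
unbump-mono c {x} {y} x≤y with c <? x | c <? y
... | yes c<x | yes c<y rewrite unbump-> c<x | unbump-> c<y = pred-mono-≤ x≤y
... | yes c<x | no  c≮y = contradiction (<-≤-trans c<x x≤y) c≮y
... | no  c≮x | yes c<y rewrite unbump-≤ (≮⇒≥ c≮x) | unbump-> c<y = ≤-trans (≮⇒≥ c≮x) (<⇒≤pred c<y)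
... | no  c≮x | no  c≮y rewrite unbump-≤ (≮⇒≥ c≮x) | unbump-≤ (≮⇒≥ c≮y) = x≤y

unbump-above : suc c < y → c < unbump c y
unbump-above {c} 1+c<y = ≤-trans (≤-reflexive (sym (unbump-> (m<n⇒m<1+n (n<1+n c))))) (unbump-mono c 1+c<y)

unbump-pres-< : m < c → m < y → m < unbump c y
unbump-pres-< {c = c} m<c m<y = ≤-trans (≤-reflexive (sym (unbump-≤ m<c))) (unbump-mono c m<y)

unbump-strictMono : ∀ c {x y} → x ≢ c → y ≢ c → x < y → unbump c x < unbump c y
unbump-strictMono c {x} {y} x≢c y≢c x<y =
  ≰⇒> λ uy≤ux → <⇒≱ x<y
    (subst₂ _≤_ (bump-unbump c y y≢c) (bump-unbump c x x≢c) (bump-mono c uy≤ux))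

maxL-↭ : xs ↭ ys → maxL xs ≡ maxL ys
maxL-↭ p = ↭ₛ.foldr-commMonoid (setoid ℕ) ⊔-0-isCommutativeMonoid (↭⇒↭ₛ p)

maxL-∈ : x ∈ xs → maxL xs ∈ xs
maxL-∈ {xs = x ∷ xs} _ = maxL-∈-∷ x xs
  where
  maxL-∈-∷ : ∀ x xs → maxL (x ∷ xs) ∈ x ∷ xs
  maxL-∈-∷ x []       = here (⊔-identityʳ x)
  maxL-∈-∷ x (y ∷ ys) with ≤-total x (maxL (y ∷ ys))
  ... | inj₁ x≤m = there (subst (_∈ y ∷ ys) (sym (m≤n⇒m⊔n≡n x≤m)) (maxL-∈-∷ y ys))
  ... | inj₂ m≤x = here (m≥n⇒m⊔n≡m m≤x)

maxL-map : ∀ {f} → f Preserves _≤_ ⟶ _≤_ → x ∈ xs → maxL (map f xs) ≡ f (maxL xs)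
maxL-map {xs = x ∷ []} {f = f} mono _ = trans (⊔-identityʳ (f x)) (cong f (sym (⊔-identityʳ x)))
maxL-map {xs = x ∷ y ∷ ys} {f = f} mono _ =
  trans (cong (f x ⊔_) (maxL-map {xs = y ∷ ys} mono (here refl))) (sym (mono-≤-distrib-⊔ mono x _))

range1-suc : ∀ k → range1 (suc k) ≡ range1 k ++ [ suc k ]
range1-suc k = trans (cong (map suc) (sym (upTo-∷ʳ k))) (map-++ suc (upTo k) [ k ])

∈-range1⁻ : x ∈ range1 k → 1 ≤ x × x ≤ k
∈-range1⁻ x∈ with ∈-map⁻ suc x∈
... | y , y∈ , refl = s≤s z≤n , ∈-upTo⁻ y∈

length-range1 : ∀ k → length (range1 k) ≡ k
length-range1 k = trans (length-map suc (upTo k)) (length-upTo k)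

range1-unique : ∀ k → Unique (range1 k)
range1-unique k = Unique.map⁺ suc-injective (Unique.upTo⁺ k)

Unique-resp-↭ : xs ↭ ys → Unique xs → Unique ys
Unique-resp-↭ p = ↭ₛ.Unique-resp-↭ (setoid ℕ) (↭⇒↭ₛ p)

map-bump-below : ∀ {xs} → All (_< a) xs → map (bump a) xs ≡ xs
map-bump-below []             = refl
map-bump-below (x<a ∷ xs<a) = cong₂ _∷_ (bump-< x<a) (map-bump-below xs<a)

range1-insert : ∀ k → 1 ≤ a → a ≤ suc k → a ∷ map (bump a) (range1 k) ↭ range1 (suc k)
range1-insert zero    1≤a a≤1 with ≤-antisym a≤1 1≤a
... | refl = ↭-refl
range1-insert {a} (suc k) 1≤a a≤2+k with m≤n⇒m<n∨m≡n a≤2+k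
... | inj₂ refl = begin
  a ∷ map (bump a) (range1 (suc k)) ≡⟨ cong (a ∷_) (map-bump-below (All.tabulate (s≤s ∘ proj₂ ∘ ∈-range1⁻))) ⟩
  [ a ] ++ range1 (suc k)           ↭⟨ ++-comm [ a ] (range1 (suc k)) ⟩
  range1 (suc k) ++ [ a ]           ≡⟨ sym (range1-suc (suc k)) ⟩
  range1 (suc (suc k))              ∎
  where open PermutationReasoning
... | inj₁ (s≤s a≤1+k) = begin
  a ∷ map (bump a) (range1 (suc k))                     ≡⟨ cong (λ l → a ∷ map (bump a) l) (range1-suc k) ⟩
  a ∷ map (bump a) (range1 k ++ [ suc k ])              ≡⟨ cong (a ∷_) (map-++ (bump a) (range1 k) [ suc k ]) ⟩
  (a ∷ map (bump a) (range1 k)) ++ [ bump a (suc k) ]   ≡⟨ cong (λ z → (a ∷ map (bump a) (range1 k)) ++ [ z ]) (bump-≥ a≤1+k) ⟩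
  (a ∷ map (bump a) (range1 k)) ++ [ suc (suc k) ]      ↭⟨ ++⁺ʳ [ suc (suc k) ] (range1-insert k 1≤a a≤1+k) ⟩
  range1 (suc k) ++ [ suc (suc k) ]                     ≡⟨ sym (range1-suc (suc k)) ⟩
  range1 (suc (suc k))                                  ∎
  where open PermutationReasoning

AndreI-map : ∀ {f w} (P : ℕ → Set) → f Preserves _≤_ ⟶ _≤_ →
  (∀ {x y} → P x → P y → x < y → f x < f y) → All P w → AndreI w → AndreI (map f w)
AndreI-map P mono strict _ andre-nil = andre-nil
AndreI-map {f = f} P mono strict _ (andre-single x) = andre-single (f x)
AndreI-map {f = f} P mono strict Pw (andre-split v m v' Av Av' m<vv' max∈v') =
  subst AndreI (sym (map-++ f v (m ∷ v')))
    (andre-split (map f v) (f m) (map f v')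
      (AndreI-map P mono strict Pv Av) (AndreI-map P mono strict Pv' Av') fm<fvv' fmax∈fv')
  where
  Pv : All P v
  Pv = All.++⁻ˡ v Pw
  Pm : P m
  Pm = All.head (All.++⁻ʳ v Pw)
  Pv' : All P v'
  Pv' = All.tail (All.++⁻ʳ v Pw)
  f[vv']≡fv++fv' : map f (v ++ v') ≡ map f v ++ map f v'
  f[vv']≡fv++fv' = map-++ f v v'
  fm<fvv' : All (f m <_) (map f v ++ map f v')
  fm<fvv' = subst (All (f m <_)) f[vv']≡fv++fv'
    (All.map⁺ (All.zipWith (λ (Px , m<x) → strict Pm Px m<x) (All.++⁺ Pv Pv' , m<vv')))
  fmax∈fv' : maxL (map f v ++ map f v') ∈ map f v'
  fmax∈fv' = subst (_∈ map f v')
    (trans (sym (maxL-map mono (∈-++⁺ʳ v max∈v'))) (cong maxL f[vv']≡fv++fv'))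
    (∈-map⁺ f max∈v')

AndreI-map-bump : ∀ {w} a → AndreI w → AndreI (map (bump a) w)
AndreI-map-bump {w} a = AndreI-map (λ _ → ⊤) (bump-mono a) (λ _ _ → bump-strictMono a) (All.universal _ w)

maxL-insert : ∀ v → m ≤ maxL (v ++ v') → maxL (v ++ m ∷ v') ≡ maxL (v ++ v')
maxL-insert {m} {v'} v m≤max = trans (maxL-↭ (shift m v v')) (m≤n⇒m⊔n≡n m≤max)

AndreI-maxL-∈-tail : ∀ {w} → AndreI w → 2 ≤ length w → maxL w ∈ drop 1 w
AndreI-maxL-∈-tail (andre-single _) (s≤s ())
AndreI-maxL-∈-tail (andre-split [] m v' _ _ m<v' max∈v') _ =
  subst (_∈ v') (sym (maxL-insert {v' = v'} [] (<⇒≤ (All.lookup m<v' max∈v')))) max∈v'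
AndreI-maxL-∈-tail (andre-split (a ∷ v) m v' _ _ m<vv' max∈v') _ =
  subst (_∈ v ++ m ∷ v')
    (sym (maxL-insert {v' = v'} (a ∷ v) (<⇒≤ (All.lookup m<vv' (∈-++⁺ʳ (a ∷ v) max∈v')))))
    (∈-++⁺ʳ v (there max∈v'))

AndreI-head<maxL : ∀ {r} → AndreI (x ∷ y ∷ r) → Unique (x ∷ y ∷ r) → x < maxL (x ∷ y ∷ r)
AndreI-head<maxL A (x∉ ∷ _) =
  ≤∧≢⇒< (m≤m⊔n _ _) (All.lookup x∉ (AndreI-maxL-∈-tail A (s≤s (s≤s z≤n))))

-- hook agrees with Θ on words of length at least 2 (definitionally), and also acts on
-- one-letter words, which occur as left factors in the André decomposition.
hook : List ℕ → List ℕ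
hook []      = []
hook (a ∷ r) = if a <ᵇ head0 r then suc a ∷ a ∷ map (bump a) r else a ∷ suc a ∷ map (bump a) r

hook-ascent : ∀ {a} r → a < head0 r → hook (a ∷ r) ≡ suc a ∷ a ∷ map (bump a) r
hook-ascent _ a<r rewrite <⇒<ᵇ≡true a<r = refl

hook-descent : ∀ {a} r → head0 r ≤ a → hook (a ∷ r) ≡ a ∷ suc a ∷ map (bump a) r
hook-descent _ r≤a rewrite ≥⇒<ᵇ≡false r≤a = refl

hook-↭ : ∀ a r → hook (a ∷ r) ↭ a ∷ map (bump a) (a ∷ r)
hook-↭ a r = subst (λ z → hook (a ∷ r) ↭ a ∷ z ∷ map (bump a) r) (sym (bump-self a)) hook↭
  where
  hook↭ : hook (a ∷ r) ↭ a ∷ suc a ∷ map (bump a) r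
  hook↭ with a <? head0 r
  ... | yes a<r = ↭-trans (↭-reflexive (hook-ascent r a<r)) (↭-swap (suc a) a ↭-refl)
  ... | no  a≮r = ↭-reflexive (hook-descent r (≮⇒≥ a≮r))

map-++-∷-fixed : ∀ {f} → f m ≡ m → ∀ v → map f (v ++ m ∷ v') ≡ map f v ++ m ∷ map f v'
map-++-∷-fixed {m} {v'} {f} fm≡m v =
  trans (map-++ f v (m ∷ v')) (cong (λ z → map f v ++ z ∷ map f v') fm≡m)

hook-++-∷ : m < a → ∀ v → hook (a ∷ v ++ m ∷ v') ≡ hook (a ∷ v) ++ m ∷ map (bump a) v'
hook-++-∷ {m} {a} {v'} m<a [] rewrite hook-descent (m ∷ v') (<⇒≤ m<a) | bump-< m<a = refl
hook-++-∷ {m} {a} {v'} m<a (b ∷ v) with a <ᵇ b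
... | true  = cong (λ z → suc a ∷ a ∷ bump a b ∷ z) (map-++-∷-fixed (bump-< m<a) v)
... | false = cong (λ z → a ∷ suc a ∷ bump a b ∷ z) (map-++-∷-fixed (bump-< m<a) v)

hook-++-↭ : ∀ a v v' → hook (a ∷ v) ++ map (bump a) v' ↭ a ∷ map (bump a) (a ∷ v ++ v')
hook-++-↭ a v v' = begin
  hook (a ∷ v) ++ map (bump a) v'               ↭⟨ ++⁺ʳ (map (bump a) v') (hook-↭ a v) ⟩
  a ∷ map (bump a) (a ∷ v) ++ map (bump a) v'   ≡⟨ cong (a ∷_) (sym (map-++ (bump a) (a ∷ v) v')) ⟩
  a ∷ map (bump a) (a ∷ v ++ v')                ∎
  where open PermutationReasoning

maxL-∷-map-bump : ∀ a xs → maxL (a ∷ map (bump a) (a ∷ xs)) ≡ bump a (maxL (a ∷ xs))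
maxL-∷-map-bump a xs = begin
  a ⊔ maxL (map (bump a) (a ∷ xs)) ≡⟨ cong (a ⊔_) (maxL-map {xs = a ∷ xs} (bump-mono a) (here refl)) ⟩
  a ⊔ bump a (maxL (a ∷ xs))       ≡⟨ m≤n⇒m⊔n≡n (≤-trans (m≤m⊔n a _) (≤-bump a _)) ⟩
  bump a (maxL (a ∷ xs))           ∎
  where open ≡-Reasoning

All-<-map-bump : ∀ {xs} → All (m <_) xs → All (m <_) (map (bump a) xs)
All-<-map-bump {a = a} = All.map⁺ ∘ All.map (λ {y} m<y → <-≤-trans m<y (≤-bump a y))

AndreI-hook : ∀ {w} → AndreI w → AndreI (hook w)
AndreI-hook andre-nil = andre-nil
AndreI-hook (andre-single x) =
  andre-split [] x [ suc x ] andre-nil (andre-single (suc x)) (n<1+n x ∷ []) (here (⊔-identityʳ (suc x)))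
AndreI-hook (andre-split [] m [] _ _ _ ())
AndreI-hook (andre-split [] m (b ∷ v') _ Av' m<v' _) =
  subst AndreI (sym (hook-ascent (b ∷ v') (All.head m<v')))
    (andre-split [ suc m ] m (map (bump m) (b ∷ v')) (andre-single (suc m)) (AndreI-map-bump m Av')
      (n<1+n m ∷ All-<-map-bump {a = m} m<v') max∈)
  where
  1+m≤max : suc m ≤ maxL (map (bump m) (b ∷ v'))
  1+m≤max = ≤-trans (All.head m<v') (≤-trans (≤-bump m b) (m≤m⊔n _ _))
  max∈ : maxL (suc m ∷ map (bump m) (b ∷ v')) ∈ map (bump m) (b ∷ v')
  max∈ = subst (_∈ map (bump m) (b ∷ v')) (sym (m≤n⇒m⊔n≡n 1+m≤max)) (maxL-∈ (here refl))
AndreI-hook (andre-split (a ∷ v) m v' Av Av' m<vv' max∈v') =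
  subst AndreI (sym (hook-++-∷ m<a v))
    (andre-split (hook (a ∷ v)) m (map (bump a) v') (AndreI-hook Av) (AndreI-map-bump a Av') m<hook max∈)
  where
  m<a : m < a
  m<a = All.head m<vv'
  m<hook : All (m <_) (hook (a ∷ v) ++ map (bump a) v')
  m<hook = All-resp-↭ (↭-sym (hook-++-↭ a v v')) (m<a ∷ All-<-map-bump {a = a} m<vv')
  max∈ : maxL (hook (a ∷ v) ++ map (bump a) v') ∈ map (bump a) v'
  max∈ = subst (_∈ map (bump a) v')
    (sym (trans (maxL-↭ (hook-++-↭ a v v')) (maxL-∷-map-bump a (v ++ v'))))
    (∈-map⁺ (bump a) max∈v')

Θ-↭ : ∀ {r} → x ∷ y ∷ r ↭ range1 k → Θ (x ∷ y ∷ r) ↭ range1 (suc k)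
Θ-↭ {x} {y} {k} {r} p with ∈-range1⁻ (∈-resp-↭ p (here refl))
... | 1≤x , x≤k = begin
  hook (x ∷ y ∷ r)                   ↭⟨ hook-↭ x (y ∷ r) ⟩
  x ∷ map (bump x) (x ∷ y ∷ r)       ↭⟨ ↭-prep x (map⁺ (bump x) p) ⟩
  x ∷ map (bump x) (range1 k)        ↭⟨ range1-insert k 1≤x (≤-trans x≤k (n≤1+n k)) ⟩
  range1 (suc k)                     ∎
  where open PermutationReasoning

unΘ : List ℕ → List ℕ
unΘ (p ∷ q ∷ r) = (p ⊓ q) ∷ map (unbump (p ⊓ q)) r
unΘ u           = u

unΘ-∷-∷ : ∀ {p q} r → p ⊓ q ≡ c → unΘ (p ∷ q ∷ r) ≡ c ∷ map (unbump c) r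
unΘ-∷-∷ r refl = refl

map-unbump-bump : ∀ c xs → map (unbump c) (map (bump c) xs) ≡ xs
map-unbump-bump c []       = refl
map-unbump-bump c (x ∷ xs) = cong₂ _∷_ (unbump-bump c x) (map-unbump-bump c xs)

map-bump-unbump : ∀ {xs} → All (_≢ c) xs → map (bump c) (map (unbump c) xs) ≡ xs
map-bump-unbump         []             = refl
map-bump-unbump {c} {x ∷ _} (x≢c ∷ xs≢c) = cong₂ _∷_ (bump-unbump c x x≢c) (map-bump-unbump xs≢c)

unΘ-∷-∷-map-bump : ∀ {p q} xs → p ⊓ q ≡ c → unΘ (p ∷ q ∷ map (bump c) xs) ≡ c ∷ xs
unΘ-∷-∷-map-bump {c} xs p⊓q≡c = trans (unΘ-∷-∷ _ p⊓q≡c) (cong (c ∷_) (map-unbump-bump c xs))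

unΘ-Θ : ∀ x y r → unΘ (Θ (x ∷ y ∷ r)) ≡ x ∷ y ∷ r
unΘ-Θ x y r with x <? y
... | yes x<y =
  trans (cong unΘ (hook-ascent (y ∷ r) x<y)) (unΘ-∷-∷-map-bump (y ∷ r) (m≥n⇒m⊓n≡n (n≤1+n x)))
... | no  x≮y =
  trans (cong unΘ (hook-descent (y ∷ r) (≮⇒≥ x≮y))) (unΘ-∷-∷-map-bump (y ∷ r) (m≤n⇒m⊓n≡m (n≤1+n x)))

-- Hooked, relaxed so that it passes to prefixes: the third letter is constrained only if present.
data HookedAt (c : ℕ) : List ℕ → Set where
  descent : ∀ {r} → All (suc c <_) (take 1 r) → HookedAt c (suc c ∷ c ∷ r)
  ascent  : ∀ {r} → All (_< suc c) (take 1 r) → HookedAt c (c ∷ suc c ∷ r)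

module _ {c x y : ℕ} where

  HookedAt-prefix : ∀ v {l} → HookedAt c (x ∷ y ∷ v ++ l) → HookedAt c (x ∷ y ∷ v)
  HookedAt-prefix []      (descent _) = descent []
  HookedAt-prefix []      (ascent _)  = ascent []
  HookedAt-prefix (_ ∷ _) (descent h) = descent h
  HookedAt-prefix (_ ∷ _) (ascent h)  = ascent h

  HookedAt-unbump : ∀ {l} → HookedAt c (x ∷ y ∷ l) → unbump c x ≡ c × unbump c y ≡ c
  HookedAt-unbump (descent _) = unbump-suc c , unbump-self c
  HookedAt-unbump (ascent _)  = unbump-self c , unbump-suc c

  HookedAt-below : ∀ {l} → HookedAt c (x ∷ y ∷ l) → m < x → m < y → m < c
  HookedAt-below (descent _) _   m<c = m<c
  HookedAt-below (ascent _)  m<c _   = m<c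

  HookedAt-∈ : ∀ {l} → HookedAt c (x ∷ y ∷ l) → c ∈ x ∷ y ∷ l
  HookedAt-∈ (descent _) = there (here refl)
  HookedAt-∈ (ascent _)  = here refl

  HookedAt-fresh : ∀ {l} → HookedAt c (x ∷ y ∷ l) → Unique (x ∷ y ∷ l) → All (_≢ c) l
  HookedAt-fresh (descent _) (_  ∷ c∉ ∷ _) = All.map ≢-sym c∉
  HookedAt-fresh (ascent _)  (c∉ ∷ _)      = All.map ≢-sym (All.tail c∉)

maxL-unbump-∷-∷ : ∀ xs → unbump c x ≡ c → unbump c y ≡ c →
  unbump c (maxL (x ∷ y ∷ xs)) ≡ maxL (c ∷ map (unbump c) xs)
maxL-unbump-∷-∷ {c} {x} {y} xs x′≡c y′≡c = begin
  unbump c (maxL (x ∷ y ∷ xs))                       ≡⟨ sym (maxL-map {xs = x ∷ y ∷ xs} (unbump-mono c) (here refl)) ⟩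
  unbump c x ⊔ (unbump c y ⊔ maxL (map (unbump c) xs)) ≡⟨ cong₂ (λ p q → p ⊔ (q ⊔ _)) x′≡c y′≡c ⟩
  c ⊔ (c ⊔ maxL (map (unbump c) xs))                 ≡⟨ sym (⊔-assoc c c _) ⟩
  c ⊔ c ⊔ maxL (map (unbump c) xs)                   ≡⟨ cong (_⊔ maxL (map (unbump c) xs)) (⊔-idem c) ⟩
  c ⊔ maxL (map (unbump c) xs)                       ∎
  where open ≡-Reasoning

Unique-++⁻ˡ : ∀ xs → Unique (xs ++ ys) → Unique xs
Unique-++⁻ˡ []       _            = []
Unique-++⁻ˡ (x ∷ xs) (x∉ ∷ xs++ys!) = All.++⁻ˡ xs x∉ ∷ Unique-++⁻ˡ xs xs++ys!

AndreI-unhook : ∀ {u} → AndreI u → Unique u → HookedAt c u → AndreI (c ∷ map (unbump c) (drop 2 u))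
AndreI-unhook andre-nil                        _ ()
AndreI-unhook (andre-single _)                 _ ()
AndreI-unhook (andre-split [] _ [] _ _ _ _)    _ ()
AndreI-unhook (andre-split [] _ (_ ∷ _) _ _ (1+c<c ∷ _) _) _ (descent _) =
  contradiction 1+c<c (<-asym (n<1+n _))
AndreI-unhook (andre-split [] _ (_ ∷ []) _ _ _ _) _ (ascent _) = andre-single _
AndreI-unhook (andre-split [] _ (_ ∷ _ ∷ _) _ _ (_ ∷ c<z ∷ _) _) _ (ascent (z<1+c ∷ [])) =
  contradiction (s≤s⁻¹ z<1+c) (<⇒≱ c<z)
AndreI-unhook (andre-split (_ ∷ []) _ _ _ _ (1+c<c ∷ _) _) _ (ascent _) =
  contradiction 1+c<c (<-asym (n<1+n _))
AndreI-unhook {c} (andre-split (_ ∷ []) _ v' _ Av' (_ ∷ c<v') max∈v') (1+c∉ ∷ _) (descent _) =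
  andre-split [] c (map (unbump c) v') andre-nil
    (AndreI-map (_≢ c) (unbump-mono c) (unbump-strictMono c) v'≢c Av') c<v'′ (maxL-∈ (∈-map⁺ _ max∈v'))
  where
  v'≢c : All (_≢ c) v'
  v'≢c = All.map (≢-sym ∘ <⇒≢) c<v'
  c<v'′ : All (c <_) (map (unbump c) v')
  c<v'′ = All.map⁺ (All.zipWith (λ (c<z , 1+c≢z) → unbump-above (≤∧≢⇒< c<z 1+c≢z))
                                 (c<v' , All.tail 1+c∉))
AndreI-unhook {c} (andre-split (x ∷ y ∷ v) m v' Av Av' m<vv' max∈v') U h =
  subst AndreI (cong (c ∷_) (sym (map-++-∷-fixed (unbump-≤ (<⇒≤ m<c)) v)))
    (andre-split (c ∷ map (unbump c) v) m (map (unbump c) v')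
      (AndreI-unhook Av (Unique-++⁻ˡ (x ∷ y ∷ v) U) (HookedAt-prefix v h))
      (AndreI-map (_≢ c) (unbump-mono c) (unbump-strictMono c) v'≢c Av') m<w′ max∈)
  where
  m<c : m < c
  m<c = HookedAt-below h (All.head m<vv') (All.head (All.tail m<vv'))
  v'≢c : All (_≢ c) v'
  v'≢c = All.tail (All.++⁻ʳ v (HookedAt-fresh h U))
  [vv']′≡v′v'′ : map (unbump c) (v ++ v') ≡ map (unbump c) v ++ map (unbump c) v'
  [vv']′≡v′v'′ = map-++ (unbump c) v v'
  m<w′ : All (m <_) ((c ∷ map (unbump c) v) ++ map (unbump c) v')
  m<w′ = m<c ∷ subst (All (m <_)) [vv']′≡v′v'′
    (All.map⁺ (All.map (unbump-pres-< m<c) (All.tail (All.tail m<vv'))))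
  max∈ : maxL ((c ∷ map (unbump c) v) ++ map (unbump c) v') ∈ map (unbump c) v'
  max∈ = subst (_∈ map (unbump c) v')
    (trans (uncurry (maxL-unbump-∷-∷ {x = x} {y = y} (v ++ v')) (HookedAt-unbump h))
           (cong (λ l → maxL (c ∷ l)) [vv']′≡v′v'′))
    (∈-map⁺ (unbump c) max∈v')

hookedAt : ∀ {u} → Unique u → Hooked u →
  Σ ℕ λ c → HookedAt c u × unΘ u ≡ c ∷ map (unbump c) (drop 2 u)
hookedAt {suc c ∷ c ∷ z ∷ r} (1+c∉ ∷ _) (inj₁ (refl , c<z)) =
  c , descent (≤∧≢⇒< c<z (All.head (All.tail 1+c∉)) ∷ []) , unΘ-∷-∷ (z ∷ r) (m≥n⇒m⊓n≡n (n≤1+n c))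
hookedAt {c ∷ suc c ∷ z ∷ r} _ (inj₂ (refl , z<1+c)) =
  c , ascent (z<1+c ∷ []) , unΘ-∷-∷ (z ∷ r) (m≤n⇒m⊓n≡m (n≤1+n c))

AndreI-unΘ : ∀ {u} → AndreI u → Unique u → Hooked u → AndreI (unΘ u)
AndreI-unΘ A U H with hookedAt U H
... | c , h , unΘ-u = subst AndreI (sym unΘ-u) (AndreI-unhook A U h)

unhook-↭ : ∀ {r} → HookedAt c (x ∷ y ∷ r) → x ∷ y ∷ r ↭ range1 (suc k) →
  c ∷ map (unbump c) r ↭ range1 k
unhook-↭ {c} {x} {y} {k} {r} h p with ∈-range1⁻ (∈-resp-↭ p (HookedAt-∈ h))
... | 1≤c , c≤1+k = drop-∷ (begin
  c ∷ c ∷ map (unbump c) r                      ≡⟨ uncurry (cong₂ (λ p q → p ∷ q ∷ map (unbump c) r)) c≡x′,c≡y′ ⟩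
  map (unbump c) (x ∷ y ∷ r)                    ↭⟨ map⁺ (unbump c) p ⟩
  map (unbump c) (range1 (suc k))               ↭⟨ map⁺ (unbump c) (↭-sym (range1-insert k 1≤c c≤1+k)) ⟩
  map (unbump c) (c ∷ map (bump c) (range1 k))  ≡⟨ cong₂ _∷_ (unbump-self c) (map-unbump-bump c (range1 k)) ⟩
  c ∷ range1 k                                  ∎)
  where
  open PermutationReasoning
  c≡x′,c≡y′ : c ≡ unbump c x × c ≡ unbump c y
  c≡x′,c≡y′ = Product.map sym sym (HookedAt-unbump h)

unΘ-↭ : ∀ {u} → u ↭ range1 (suc k) → Unique u → Hooked u → unΘ u ↭ range1 k
unΘ-↭ {u = _ ∷ _ ∷ _} p U H with hookedAt U H
... | c , h , unΘ-u = ↭-trans (↭-reflexive unΘ-u) (unhook-↭ h p)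

Θ-unhook : ∀ {z r} → HookedAt c (x ∷ y ∷ z ∷ r) → All (_≢ c) (z ∷ r) →
  Θ (c ∷ map (unbump c) (z ∷ r)) ≡ x ∷ y ∷ z ∷ r
Θ-unhook {c} {z = z} {r} (descent (1+c<z ∷ [])) zr≢c =
  trans (hook-ascent (map (unbump c) (z ∷ r)) (unbump-above 1+c<z))
        (cong (λ l → suc c ∷ c ∷ l) (map-bump-unbump zr≢c))
Θ-unhook {c} {z = z} {r} (ascent (z<1+c ∷ [])) zr≢c =
  trans (hook-descent (map (unbump c) (z ∷ r)) z′≤c)
        (cong (λ l → c ∷ suc c ∷ l) (map-bump-unbump zr≢c))
  where
  z′≤c : unbump c z ≤ c
  z′≤c = ≤-trans (unbump-mono c (s≤s⁻¹ z<1+c)) (≤-reflexive (unbump-self c))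

Θ-unΘ : ∀ {u} → Unique u → Hooked u → Θ (unΘ u) ≡ u
Θ-unΘ {_ ∷ _ ∷ _ ∷ _} U H with hookedAt U H
... | c , h , unΘ-u = trans (cong Θ unΘ-u) (Θ-unhook h (HookedAt-fresh h U))

spiGo-< : ∀ {s l y} ys → y < s → spiGo s l (y ∷ ys) ≡ l
spiGo-< _ y<s rewrite <⇒<ᵇ≡true y<s = refl

spiGo-≥ : ∀ {s l y} ys → s ≤ y → spiGo s l (y ∷ ys) ≡ spiGo s y ys
spiGo-≥ _ s≤y rewrite ≥⇒<ᵇ≡false s≤y = refl

spi-Θ : ∀ {r} → x ≢ y → spi (Θ (x ∷ y ∷ r)) ≡ suc x
spi-Θ {x} {y} {r} x≢y with x <? y
... | yes x<y = trans (cong spi (hook-ascent (y ∷ r) x<y)) (spiGo-< (map (bump x) (y ∷ r)) (n<1+n x))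
... | no  x≮y = begin
  spi (Θ (x ∷ y ∷ r))                            ≡⟨ cong spi (hook-descent (y ∷ r) (≮⇒≥ x≮y)) ⟩
  spiGo x x (suc x ∷ bump x y ∷ map (bump x) r)  ≡⟨ spiGo-≥ (bump x y ∷ map (bump x) r) (n≤1+n x) ⟩
  spiGo x (suc x) (bump x y ∷ map (bump x) r)    ≡⟨ spiGo-< (map (bump x) r) (subst (_< x) (sym (bump-< y<x)) y<x) ⟩
  suc x                                          ∎
  where
  open ≡-Reasoning
  y<x : y < x
  y<x = ≤∧≢⇒< (≮⇒≥ x≮y) (≢-sym x≢y)

grnGo-≢ : ∀ {M z} p zs → z ≢ M → grnGo M p (z ∷ zs) ≡ grnGo M z zs
grnGo-≢ _ _ z≢M rewrite ≢⇒≡ᵇ≡false z≢M = refl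

grnGo-≡ : ∀ M p zs → grnGo M p (M ∷ zs) ≡ p ⊔ head0 zs
grnGo-≡ M p zs rewrite ≡ᵇ-refl M = refl

head0-map : ∀ {f} → f 0 ≡ 0 → ∀ zs → head0 (map f zs) ≡ f (head0 zs)
head0-map f0≡0 []      = sym f0≡0
head0-map f0≡0 (_ ∷ _) = refl

grnGo-map : ∀ {f} → (∀ {x y} → f x ≡ f y → x ≡ y) → f Preserves _≤_ ⟶ _≤_ → f 0 ≡ 0 →
  ∀ M p zs → grnGo (f M) (f p) (map f zs) ≡ f (grnGo M p zs)
grnGo-map {f} inj mono f0≡0 M p []       = sym f0≡0
grnGo-map {f} inj mono f0≡0 M p (z ∷ zs) with z ≟ M
... | yes refl = begin
  grnGo (f z) (f p) (f z ∷ map f zs)  ≡⟨ grnGo-≡ (f z) (f p) (map f zs) ⟩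
  f p ⊔ head0 (map f zs)              ≡⟨ cong (f p ⊔_) (head0-map f0≡0 zs) ⟩
  f p ⊔ f (head0 zs)                  ≡⟨ sym (mono-≤-distrib-⊔ mono p (head0 zs)) ⟩
  f (p ⊔ head0 zs)                    ≡⟨ cong f (sym (grnGo-≡ z p zs)) ⟩
  f (grnGo z p (z ∷ zs))              ∎
  where open ≡-Reasoning
... | no  z≢M = begin
  grnGo (f M) (f p) (f z ∷ map f zs)  ≡⟨ grnGo-≢ (f p) (map f zs) (z≢M ∘ inj) ⟩
  grnGo (f M) (f z) (map f zs)        ≡⟨ grnGo-map inj mono f0≡0 M z zs ⟩
  f (grnGo M z zs)                    ≡⟨ cong f (sym (grnGo-≢ p zs z≢M)) ⟩
  f (grnGo M p (z ∷ zs))              ∎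
  where open ≡-Reasoning

⊔-bump : ∀ x h → x ⊔ h ≢ x → x ⊔ bump x h ≡ bump x (x ⊔ h)
⊔-bump x h x⊔h≢x with ≤-total h x
... | inj₁ h≤x = contradiction (m≥n⇒m⊔n≡m h≤x) x⊔h≢x
... | inj₂ x≤h = trans (m≤n⇒m⊔n≡n (≤-trans x≤h (≤-bump x h))) (cong (bump x) (sym (m≤n⇒m⊔n≡n x≤h)))

module _ {x y r} (0<x : 0 < x) (x<M : x < maxL (x ∷ y ∷ r)) where
  private
    w : List ℕ
    w = x ∷ y ∷ r
    M : ℕ
    M = maxL w
    f : ℕ → ℕ
    f = bump x
    open ≡-Reasoning

    fM≡1+M : f M ≡ suc M
    fM≡1+M = bump-≥ (<⇒≤ x<M)

    x≢fM : x ≢ f M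
    x≢fM = <⇒≢ (<-≤-trans (m<n⇒m<1+n x<M) (≤-reflexive (sym fM≡1+M)))

    1+x≢fM : suc x ≢ f M
    1+x≢fM = <⇒≢ (<-≤-trans (s≤s x<M) (≤-reflexive (sym fM≡1+M)))

    grn-w : grn w ≡ grnGo M x (y ∷ r)
    grn-w = grnGo-≢ 0 (y ∷ r) (<⇒≢ x<M)

    grn-Θw : grn (Θ w) ≡ grnGo (f M) 0 (Θ w)
    grn-Θw = cong (λ z → grnGo z 0 (Θ w))
      (trans (maxL-↭ (hook-↭ x (y ∷ r))) (maxL-∷-map-bump x (y ∷ r)))

    grnGo-bump : ∀ p zs → grnGo (f M) (f p) (map f zs) ≡ f (grnGo M p zs)
    grnGo-bump = grnGo-map (bump-injective x) (bump-mono x) (bump-< 0<x) M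

  grn-Θ-descent : y ≤ x → grn (Θ w) ≡ f (grn w)
  grn-Θ-descent y≤x = begin
    grn (Θ w)                                  ≡⟨ trans grn-Θw (cong (grnGo (f M) 0) (hook-descent (y ∷ r) y≤x)) ⟩
    grnGo (f M) 0 (x ∷ suc x ∷ map f (y ∷ r))  ≡⟨ grnGo-≢ 0 (suc x ∷ map f (y ∷ r)) x≢fM ⟩
    grnGo (f M) x (suc x ∷ map f (y ∷ r))      ≡⟨ grnGo-≢ x (map f (y ∷ r)) 1+x≢fM ⟩
    grnGo (f M) (suc x) (map f (y ∷ r))        ≡⟨ cong (λ p → grnGo (f M) p (map f (y ∷ r))) (sym (bump-self x)) ⟩
    grnGo (f M) (f x) (map f (y ∷ r))          ≡⟨ grnGo-bump x (y ∷ r) ⟩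
    f (grnGo M x (y ∷ r))                      ≡⟨ cong f (sym grn-w) ⟩
    f (grn w)                                  ∎

  -- When y is the maximum, grn w = x ⊔ head0 r, and grn w ≢ x forces x < head0 r.
  grn-Θ-ascent : x < y → grn w ≢ x → grn (Θ w) ≡ f (grn w)
  grn-Θ-ascent x<y grn≢x = trans grn-Θw′ (from-y (y ≟ M))
    where
    grn-Θw′ : grn (Θ w) ≡ grnGo (f M) x (f y ∷ map f r)
    grn-Θw′ = begin
      grn (Θ w)                                  ≡⟨ trans grn-Θw (cong (grnGo (f M) 0) (hook-ascent (y ∷ r) x<y)) ⟩
      grnGo (f M) 0 (suc x ∷ x ∷ map f (y ∷ r))  ≡⟨ grnGo-≢ 0 (x ∷ map f (y ∷ r)) 1+x≢fM ⟩
      grnGo (f M) (suc x) (x ∷ map f (y ∷ r))    ≡⟨ grnGo-≢ (suc x) (map f (y ∷ r)) x≢fM ⟩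
      grnGo (f M) x (f y ∷ map f r)              ∎
    from-y : Dec (y ≡ M) → grnGo (f M) x (f y ∷ map f r) ≡ f (grn w)
    from-y (yes y≡M) = begin
      grnGo (f M) x (f y ∷ map f r)  ≡⟨ cong (λ z → grnGo (f M) x (f z ∷ map f r)) y≡M ⟩
      grnGo (f M) x (f M ∷ map f r)  ≡⟨ grnGo-≡ (f M) x (map f r) ⟩
      x ⊔ head0 (map f r)            ≡⟨ cong (x ⊔_) (head0-map (bump-< 0<x) r) ⟩
      x ⊔ f (head0 r)                ≡⟨ ⊔-bump x (head0 r) (grn≢x ∘ trans grn-w≡) ⟩
      f (x ⊔ head0 r)                ≡⟨ cong f (sym grn-w≡) ⟩
      f (grn w)                      ∎
      where
      grn-w≡ : grn w ≡ x ⊔ head0 r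
      grn-w≡ = trans grn-w (trans (cong (λ z → grnGo M x (z ∷ r)) y≡M) (grnGo-≡ M x r))
    from-y (no y≢M) = begin
      grnGo (f M) x (f y ∷ map f r)  ≡⟨ grnGo-≢ x (map f r) (y≢M ∘ bump-injective x) ⟩
      grnGo (f M) (f y) (map f r)    ≡⟨ grnGo-bump y r ⟩
      f (grnGo M y r)                ≡⟨ cong f (sym (trans grn-w (grnGo-≢ x r y≢M))) ⟩
      f (grn w)                      ∎

  grn-Θ : grn w ≢ x → grn (Θ w) ≡ bump x (grn w)
  grn-Θ grn≢x with x <? y
  ... | yes x<y = grn-Θ-ascent x<y grn≢x
  ... | no  x≮y = grn-Θ-descent (≮⇒≥ x≮y)

Unique-And : ∀ {k w} → And k w → Unique w
Unique-And {k} (p , _) = Unique-resp-↭ (↭-sym p) (range1-unique k)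

And-head≢ : ∀ {k r} → And k (x ∷ y ∷ r) → x ≢ y
And-head≢ a with Unique-And a
... | x∉ ∷ _ = All.head x∉

Θ-And : ∀ {k r} → And k (x ∷ y ∷ r) → And (suc k) (Θ (x ∷ y ∷ r))
Θ-And (p , A) = Θ-↭ p , AndreI-hook A

Θ-Hooked : ∀ {r} → x ≢ y → Hooked (Θ (x ∷ y ∷ r))
Θ-Hooked {x} {y} {r} x≢y with x <? y
... | yes x<y = subst Hooked (sym (hook-ascent (y ∷ r) x<y)) (inj₁ (refl , <-≤-trans x<y (≤-bump x y)))
... | no  x≮y = subst Hooked (sym (hook-descent (y ∷ r) (<⇒≤ y<x)))
                  (inj₂ (refl , subst (_< suc x) (sym (bump-< y<x)) (m<n⇒m<1+n y<x)))
  where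
  y<x : y < x
  y<x = ≤∧≢⇒< (≮⇒≥ x≮y) (≢-sym x≢y)

Hooked⇒Θ-image : ∀ {k u} → And (suc k) u → Hooked u → ∃[ w ] (And k w × Θ w ≡ u)
Hooked⇒Θ-image {u = u} a@(p , A) H = unΘ u , (unΘ-↭ p U H , AndreI-unΘ A U H) , Θ-unΘ U H
  where
  U : Unique u
  U = Unique-And a

Θ-statistics : ∀ {k r} → And k (x ∷ y ∷ r) →
  spi (Θ (x ∷ y ∷ r)) ≡ suc x
  × (x < grn (x ∷ y ∷ r) → grn (Θ (x ∷ y ∷ r)) ≡ suc (grn (x ∷ y ∷ r)))
  × (grn (x ∷ y ∷ r) < x → grn (Θ (x ∷ y ∷ r)) ≡ grn (x ∷ y ∷ r))
Θ-statistics {x} {y} {r = r} a@(p , A) =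
  spi-Θ (And-head≢ a) ,
  (λ x<g → trans (grn-Θ 0<x x<M (≢-sym (<⇒≢ x<g))) (bump-≥ (<⇒≤ x<g))) ,
  (λ g<x → trans (grn-Θ 0<x x<M (<⇒≢ g<x)) (bump-< g<x))
  where
  0<x : 0 < x
  0<x = proj₁ (∈-range1⁻ (∈-resp-↭ p (here refl)))
  x<M : x < maxL (x ∷ y ∷ r)
  x<M = AndreI-head<maxL A (Unique-And a)

And-≥2-elim : ∀ {k} {P : List ℕ → Set} → (∀ {x y r} → And (2 + k) (x ∷ y ∷ r) → P (x ∷ y ∷ r)) →
  ∀ w → And (2 + k) w → P w
And-≥2-elim {k} f []          (p , _) = contradiction (trans (↭-length p) (length-range1 (2 + k))) λ ()
And-≥2-elim {k} f (_ ∷ [])    (p , _) = contradiction (trans (↭-length p) (length-range1 (2 + k))) λ ()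
And-≥2-elim     f (_ ∷ _ ∷ _) a       = f a

Θ-injective : ∀ {k} w w' → And (2 + k) w → And (2 + k) w' → Θ w ≡ Θ w' → w ≡ w'
Θ-injective {k} w w' a a' Θw≡Θw' = trans (sym (unΘ∘Θ w a)) (trans (cong unΘ Θw≡Θw') (unΘ∘Θ w' a'))
  where
  unΘ∘Θ : ∀ w → And (2 + k) w → unΘ (Θ w) ≡ w
  unΘ∘Θ = And-≥2-elim λ _ → unΘ-Θ _ _ _

proposition6p4 : (n : ℕ) → 3 ≤ n →
    ((w : List ℕ) → And (n ∸ 1) w → And n (Θ w))
    × ((w w' : List ℕ) → And (n ∸ 1) w → And (n ∸ 1) w' → Θ w ≡ Θ w' → w ≡ w')
    × ((w : List ℕ) → And (n ∸ 1) w → Hooked (Θ w))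
    × ((u : List ℕ) → And n u → Hooked u → ∃[ w ] (And (n ∸ 1) w × Θ w ≡ u))
    × ((w : List ℕ) → And (n ∸ 1) w →
         (spi (Θ w) ≡ suc (F w))
         × (F w < grn w → grn (Θ w) ≡ suc (grn w))
         × (grn w < F w → grn (Θ w) ≡ grn w))
proposition6p4 _ (s≤s (s≤s (s≤s _))) =
  And-≥2-elim Θ-And ,
  Θ-injective ,
  And-≥2-elim (Θ-Hooked ∘ And-head≢) ,
  (λ _ → Hooked⇒Θ-image) ,
  And-≥2-elim Θ-statistics
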